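{- For $k_1,\ldots,k_r\in\mathbb{Z}_{\ge0}$ there exists a polynomial $\widetilde{P}(x_1,\ldots,x_r;k_1,\ldots,k_r)\in\mathbb{Z}[x_1,\ldots,x_r]$ such that \[\mathrm{Li}^{*}_{ -k_1,\ldots,-k_r}(z_1,\ldots,z_r)=\frac{\widetilde{P}\big(\prod_{j=1}^r z_j,\prod_{j=2}^r z_j,\ldots,z_{r-1}z_r,z_r;k_1,\ldots,k_r\big)}{\prod_{j=1}^r\big(1-\prod_{\nu=j}^r z_\nu\big)^{\sum_{\nu=j}^r k_\nu+1}},\] $\deg_{x_j}\widetilde{P}(x_1,\ldots,x_r;k_1,\ldots,k_r)\le\sum_{\nu=j}^r k_\nu+1$ for each $j$, and $x_1\cdots x_r$ divides $\widetilde{P}(x_1,\ldots,x_r;k_1,\ldots,k_r)$. Equivalently, with $y_j=\prod_{\nu=j}^r z_\nu$, \[\mathrm{Li}^{\sqcup\!\sqcup}_{ -k_1,\ldots,-k_r}(y_1,\ldots,y_r)=\frac{\widetilde{P}(y_1,\ldots,y_r;k_1,\ldots,k_r)}{\prod_{j=1}^r(1-y_j)^{\sum_{\nu=j}^r k_\nu+1}}.\]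
   Context: For complex $s_j$ and $|z_j|<1$: $\mathrm{Li}^{*}_{s_1,\ldots,s_r}(z_1,\ldots,z_r)=\sum_{1\le m_1<\cdots<m_r}\frac{z_1^{m_1}\cdots z_r^{m_r}}{m_1^{s_1}\cdots m_r^{s_r}}$ and $\mathrm{Li}^{\sqcup\!\sqcup}_{s_1,\ldots,s_r}(z_1,\ldots,z_r)=\sum_{1\le m_1<\cdots<m_r}\frac{z_1^{m_1}z_2^{m_2-m_1}\cdots z_r^{m_r-m_{r-1}}}{m_1^{s_1}\cdots m_r^{s_r}}=\sum_{l_1,\ldots,l_r\ge1}\frac{z_1^{l_1}\cdots z_r^{l_r}}{l_1^{s_1}(l_1+l_2)^{s_2}\cdots(l_1+\cdots+l_r)^{s_r}}$. -}

module Defs where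

open import Data.Nat as ℕ using (ℕ; zero; suc; _∸_; _^_; _<ᵇ_; _≤ᵇ_; _≡ᵇ_)
open import Data.Integer as ℤ using (ℤ; +_; 0ℤ; 1ℤ)
open import Data.Fin using (Fin; toℕ)
import Data.Fin as Fin
open import Data.Bool using (Bool; true; false; if_then_else_; _∧_)
open import Data.Maybe using (Maybe; just; nothing)
open import Data.Vec.Functional using (_∷_; head; tail)

MultiIdx : ℕ → Set
MultiIdx r = Fin r → ℕ

Series : ℕ → Set
Series r = MultiIdx r → ℤ

sumUpTo : ℕ → (ℕ → ℤ) → ℤ
sumUpTo zero    g = g 0
sumUpTo (suc N) g = sumUpTo N g ℤ.+ g (suc N)

boxSum : ∀ {r} → MultiIdx r → (MultiIdx r → ℤ) → ℤ
boxSum {zero}  n f = f (λ ())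
boxSum {suc r} n f = sumUpTo (head n) (λ i → boxSum (tail n) (λ m → f (i ∷ m)))

mulS : ∀ {r} → Series r → Series r → Series r
mulS F G n = boxSum n (λ m → F m ℤ.* G (λ j → n j ∸ m j))

subS : ∀ {r} → Series r → Series r → Series r
subS F G n = F n ℤ.- G n

eqIdx : ∀ {r} → MultiIdx r → MultiIdx r → Bool
eqIdx {zero}  a b = true
eqIdx {suc r} a b = (head a ≡ᵇ head b) ∧ eqIdx (tail a) (tail b)

mono : ∀ {r} → MultiIdx r → Series r
mono a n = if eqIdx a n then 1ℤ else 0ℤ

oneS : ∀ {r} → Series r
oneS = mono (λ _ → 0)

varS : ∀ {r} → Fin r → Series r
varS j = mono (λ i → if toℕ j ≡ᵇ toℕ i then 1 else 0)

powS : ∀ {r} → Series r → ℕ → Series r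
powS F zero    = oneS
powS F (suc e) = mulS F (powS F e)

prodS : ∀ {r s} → (Fin s → Series r) → Series r
prodS {s = zero}  f = oneS
prodS {s = suc s} f = mulS (f Fin.zero) (prodS (λ j → f (Fin.suc j)))

sumF : ∀ {r} → (Fin r → ℕ) → ℕ
sumF {zero}  k = 0
sumF {suc r} k = head k ℕ.+ sumF (tail k)

-- expo k j = Σ_{ν = j}^{r} k_ν + 1   (0-indexed j)
expo : ∀ {r} → (Fin r → ℕ) → Fin r → ℕ
expo k Fin.zero    = sumF k ℕ.+ 1
expo k (Fin.suc j) = expo (tail k) j

-- Coefficient of y^l in Li^ш_{-k_1,…,-k_r}(y_1,…,y_r):
--   l_1^{k_1} (l_1+l_2)^{k_2} ⋯ (l_1+⋯+l_r)^{k_r}  if all l_j ≥ 1, else 0.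
liShGo : ∀ {r} → ℕ → (Fin r → ℕ) → MultiIdx r → ℕ
liShGo {zero}  acc k l = 1
liShGo {suc r} acc k l =
  if head l ≡ᵇ 0 then 0
  else (acc ℕ.+ head l) ^ head k ℕ.* liShGo (acc ℕ.+ head l) (tail k) (tail l)

LiSh : ∀ {r} → (Fin r → ℕ) → Series r
LiSh k l = + liShGo 0 k l

-- Coefficient of z^m in Li^*_{-k_1,…,-k_r}(z_1,…,z_r):
--   m_1^{k_1} ⋯ m_r^{k_r}  if 1 ≤ m_1 < ⋯ < m_r, else 0.
liStarGo : ∀ {r} → ℕ → (Fin r → ℕ) → MultiIdx r → ℕ
liStarGo {zero}  prev k m = 1
liStarGo {suc r} prev k m =
  if prev <ᵇ head m then head m ^ head k ℕ.* liStarGo (head m) (tail k) (tail m)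
  else 0

LiStar : ∀ {r} → (Fin r → ℕ) → Series r
LiStar k m = + liStarGo 0 k m

-- y_j = ∏_{ν = j}^{r} z_ν as a monomial in z: exponent vector tailInd j
tailInd : ∀ {r} → Fin r → MultiIdx r
tailInd j i = if toℕ j ≤ᵇ toℕ i then 1 else 0

-- Under y_j = z_j ⋯ z_r, y^l = z^m with m_j = l_1 + ⋯ + l_j.
-- Decode m back to l (successive differences), if m is nondecreasing.
decodeGo : ∀ {r} → ℕ → MultiIdx r → Maybe (MultiIdx r)
decodeGo {zero}  prev m = just (λ ())
decodeGo {suc r} prev m with prev ≤ᵇ head m | decodeGo (head m) (tail m)
... | true  | just l = just ((head m ∸ prev) ∷ l)
... | true  | nothing = nothing
... | false | _ = nothing

-- The z-series of P(z_1⋯z_r, z_2⋯z_r, …, z_r) for a series P in y.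
substY : ∀ {r} → Series r → Series r
substY P m with decodeGo 0 m
... | just l  = P l
... | nothing = 0ℤ

{-# OPTIONS --safe #-}
-- Clearing denominators, P = Li^ш · ∏ⱼ (1 − yⱼ)^eⱼ with eⱼ = kⱼ + ⋯ + k_r + 1, and ∏ⱼ (1 − yⱼ)^eⱼ
-- is a tensor product of one-variable series. Peeling off the first variable, the coefficient
-- of y^n is the convolution of (1 − y)^e₁ with i ↦ i^k₁ · c(i), where c(s) is the coefficient of
-- the remaining variables with all their partial sums shifted by s. Allowing an initial shift,
-- induction on r shows that c is a polynomial of degree k₂ + ⋯ + k_r, so i ↦ i^k₁ · c(i) has
-- degree e₁ − 1, and convolving with (1 − y)^e₁ is an e₁-fold finite difference: the
-- coefficient vanishes once n₁ > e₁. Divisibility by y₁⋯y_r comes from the vanishing of the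
-- Li^ш coefficients when some lⱼ = 0. The *-form follows since yⱼ = zⱼ⋯z_r maps monomials
-- injectively, hence is multiplicative on coefficients, and it sends Li^ш to Li^*.
module Submission where

open import Defs
open import Data.Nat using (ℕ; _<_)
open import Data.Integer using (ℤ; 0ℤ)
open import Data.Fin using (Fin)
open import Data.Product using (Σ; _×_)
open import Relation.Binary.PropositionalEquality using (_≡_)

import Algebra.Properties.CommutativeSemigroup as CommSemigroupProperties
open import Data.Bool using (Bool; true; false; if_then_else_; _∧_; T)
open import Data.Bool.Properties using (T-≡; ¬-not)
open import Data.Fin as Fin using (toℕ)
open import Data.Integer using (+_; 1ℤ; -1ℤ; _+_; _-_; _*_)
import Data.Integer.Properties as ℤₚ
open import Data.Integer.Tactic.RingSolver using (solve-∀)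
open import Data.Maybe using (just; nothing; maybe′)
open import Data.Nat as ℕ using (zero; suc; _∸_; _≤_; _≰_; _≮_; _≤ᵇ_; _<ᵇ_; _≡ᵇ_; z≤n)
import Data.Nat.Properties as ℕₚ
open import Data.Product using (_,_)
open import Data.Unit using (tt)
open import Data.Vec.Functional using (_∷_; head; tail)
open import Function using (_∘_)
open import Function.Bundles using (Equivalence)
open import Relation.Binary.Definitions using (tri<; tri≈; tri>)
open import Relation.Binary.PropositionalEquality
  using (_≢_; _≗_; refl; sym; trans; cong; cong₂; subst; module ≡-Reasoning)
open import Relation.Nullary using (¬_; yes; no)

open CommSemigroupProperties ℤₚ.*-commutativeSemigroup using (interchange)

T⇒≡true : ∀ {b} → T b → b ≡ true
T⇒≡true = Equivalence.to T-≡

¬T⇒≡false : ∀ {b} → ¬ T b → b ≡ false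
¬T⇒≡false ¬Tb = ¬-not (¬Tb ∘ Equivalence.from T-≡)

≤⇒≤ᵇ≡true : ∀ {m n} → m ≤ n → (m ≤ᵇ n) ≡ true
≤⇒≤ᵇ≡true = T⇒≡true ∘ ℕₚ.≤⇒≤ᵇ

≰⇒≤ᵇ≡false : ∀ {m n} → m ≰ n → (m ≤ᵇ n) ≡ false
≰⇒≤ᵇ≡false {m} {n} m≰n = ¬T⇒≡false (m≰n ∘ ℕₚ.≤ᵇ⇒≤ m n)

≤ᵇ≡true⇒≤ : ∀ {m n} → (m ≤ᵇ n) ≡ true → m ≤ n
≤ᵇ≡true⇒≤ {m} {n} eq = ℕₚ.≤ᵇ⇒≤ m n (subst T (sym eq) tt)

<⇒<ᵇ≡true : ∀ {m n} → m < n → (m <ᵇ n) ≡ true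
<⇒<ᵇ≡true = T⇒≡true ∘ ℕₚ.<⇒<ᵇ

≮⇒<ᵇ≡false : ∀ {m n} → m ≮ n → (m <ᵇ n) ≡ false
≮⇒<ᵇ≡false {m} {n} m≮n = ¬T⇒≡false (m≮n ∘ ℕₚ.<ᵇ⇒< m n)

≡⇒≡ᵇ≡true : ∀ {m n} → m ≡ n → (m ≡ᵇ n) ≡ true
≡⇒≡ᵇ≡true {m} {n} = T⇒≡true ∘ ℕₚ.≡⇒≡ᵇ m n

≢⇒≡ᵇ≡false : ∀ {m n} → m ≢ n → (m ≡ᵇ n) ≡ false
≢⇒≡ᵇ≡false {m} {n} m≢n = ¬T⇒≡false (m≢n ∘ ℕₚ.≡ᵇ⇒≡ m n)

≤ᵇ-suc : ∀ m n → (suc m ≤ᵇ suc n) ≡ (m ≤ᵇ n)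
≤ᵇ-suc zero    n = refl
≤ᵇ-suc (suc m) n = refl

guard : Bool → ℤ → ℤ
guard b x = if b then x else 0ℤ

sumUpTo-cong : ∀ N {f g : ℕ → ℤ} → (∀ i → i ≤ N → f i ≡ g i) → sumUpTo N f ≡ sumUpTo N g
sumUpTo-cong zero    f≡g = f≡g 0 z≤n
sumUpTo-cong (suc N) f≡g =
  cong₂ _+_ (sumUpTo-cong N (λ i i≤N → f≡g i (ℕₚ.m≤n⇒m≤1+n i≤N))) (f≡g (suc N) ℕₚ.≤-refl)

sumUpTo-zero : ∀ N {f : ℕ → ℤ} → (∀ i → i ≤ N → f i ≡ 0ℤ) → sumUpTo N f ≡ 0ℤ
sumUpTo-zero zero    f≡0 = f≡0 0 z≤n
sumUpTo-zero (suc N) f≡0 =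
  cong₂ _+_ (sumUpTo-zero N (λ i i≤N → f≡0 i (ℕₚ.m≤n⇒m≤1+n i≤N))) (f≡0 (suc N) ℕₚ.≤-refl)

sumUpTo-suc : ∀ N (f : ℕ → ℤ) → sumUpTo (suc N) f ≡ f 0 + sumUpTo N (f ∘ suc)
sumUpTo-suc zero    f = refl
sumUpTo-suc (suc N) f = trans (cong (_+ f (2 ℕ.+ N)) (sumUpTo-suc N f)) (ℤₚ.+-assoc (f 0) _ _)

*-distribʳ-sumUpTo : ∀ N (f : ℕ → ℤ) c → sumUpTo N f * c ≡ sumUpTo N (λ i → f i * c)
*-distribʳ-sumUpTo zero    f c = refl
*-distribʳ-sumUpTo (suc N) f c =
  trans (ℤₚ.*-distribʳ-+ c (sumUpTo N f) (f (suc N))) (cong (_+ f (suc N) * c) (*-distribʳ-sumUpTo N f c))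

*-distribˡ-sumUpTo : ∀ N (f : ℕ → ℤ) c → c * sumUpTo N f ≡ sumUpTo N (λ i → c * f i)
*-distribˡ-sumUpTo zero    f c = refl
*-distribˡ-sumUpTo (suc N) f c =
  trans (ℤₚ.*-distribˡ-+ c (sumUpTo N f) (f (suc N))) (cong (_+ c * f (suc N)) (*-distribˡ-sumUpTo N f c))

sumUpTo-sub : ∀ N (f g : ℕ → ℤ) → sumUpTo N (λ i → f i - g i) ≡ sumUpTo N f - sumUpTo N g
sumUpTo-sub zero    f g = refl
sumUpTo-sub (suc N) f g =
  trans (cong (_+ (f (suc N) - g (suc N))) (sumUpTo-sub N f g))
        (regroup (sumUpTo N f) (sumUpTo N g) (f (suc N)) (g (suc N)))
  where
  regroup : ∀ a b c d → a - b + (c - d) ≡ a + c - (b + d)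
  regroup = solve-∀

boxSum-cong : ∀ {r} (n : MultiIdx r) {f g : MultiIdx r → ℤ} → f ≗ g → boxSum n f ≡ boxSum n g
boxSum-cong {zero}  n f≗g = f≗g _
boxSum-cong {suc r} n f≗g = sumUpTo-cong (head n) (λ i _ → boxSum-cong (tail n) (f≗g ∘ (i ∷_)))

boxSum-zero : ∀ {r} (n : MultiIdx r) {f : MultiIdx r → ℤ} → (∀ m → f m ≡ 0ℤ) → boxSum n f ≡ 0ℤ
boxSum-zero {zero}  n f≡0 = f≡0 _
boxSum-zero {suc r} n f≡0 = sumUpTo-zero (head n) (λ i _ → boxSum-zero (tail n) (f≡0 ∘ (i ∷_)))

*-distribˡ-boxSum : ∀ {r} (n : MultiIdx r) (f : MultiIdx r → ℤ) c → c * boxSum n f ≡ boxSum n (λ m → c * f m)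
*-distribˡ-boxSum {zero}  n f c = refl
*-distribˡ-boxSum {suc r} n f c =
  trans (*-distribˡ-sumUpTo (head n) _ c) (sumUpTo-cong (head n) (λ i _ → *-distribˡ-boxSum (tail n) _ c))

boxSum-resp-≗ : ∀ {r} {n n′ : MultiIdx r} (f : MultiIdx r → ℤ) → n ≗ n′ → boxSum n f ≡ boxSum n′ f
boxSum-resp-≗ {zero}          f n≗n′ = refl
boxSum-resp-≗ {suc r} {n} {n′} f n≗n′ rewrite n≗n′ Fin.zero =
  sumUpTo-cong (head n′) (λ i _ → boxSum-resp-≗ (f ∘ (i ∷_)) (n≗n′ ∘ Fin.suc))

-- Without function extensionality, a series must be shown to respect pointwise equality of
-- multi-indices before its arguments can be rewritten.
Extensional : ∀ {r} → Series r → Set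
Extensional F = ∀ {a b} → a ≗ b → F a ≡ F b

mulS-cong : ∀ {r} {F F′ G G′ : Series r} → F ≗ F′ → G ≗ G′ → mulS F G ≗ mulS F′ G′
mulS-cong F≗F′ G≗G′ n = boxSum-cong n (λ m → cong₂ _*_ (F≗F′ m) (G≗G′ _))

mulS-congʳ : ∀ {r} (F : Series r) {G G′ : Series r} → G ≗ G′ → mulS F G ≗ mulS F G′
mulS-congʳ F = mulS-cong {F = F} (λ _ → refl)

mulS-extensional : ∀ {r} (F G : Series r) → Extensional G → Extensional (mulS F G)
mulS-extensional F G G-ext {a} {b} a≗b =
  trans (boxSum-resp-≗ _ a≗b) (boxSum-cong b (λ m → cong (F m *_) (G-ext (λ j → cong (_∸ m j) (a≗b j)))))

eqIdx-resp-≗ : ∀ {r} {a a′ b b′ : MultiIdx r} → a ≗ a′ → b ≗ b′ → eqIdx a b ≡ eqIdx a′ b′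
eqIdx-resp-≗ {zero}  a≗a′ b≗b′ = refl
eqIdx-resp-≗ {suc r} a≗a′ b≗b′ =
  cong₂ _∧_ (cong₂ _≡ᵇ_ (a≗a′ Fin.zero) (b≗b′ Fin.zero)) (eqIdx-resp-≗ (a≗a′ ∘ Fin.suc) (b≗b′ ∘ Fin.suc))

mono-extensional : ∀ {r} (a : MultiIdx r) → Extensional (mono a)
mono-extensional a b≗b′ = cong (λ b → guard b 1ℤ) (eqIdx-resp-≗ (λ _ → refl) b≗b′)

mono-resp-≗ : ∀ {r} {a a′ : MultiIdx r} → a ≗ a′ → mono a ≗ mono a′
mono-resp-≗ a≗a′ n = cong (λ b → guard b 1ℤ) (eqIdx-resp-≗ a≗a′ (λ _ → refl))

powS-extensional : ∀ {r} (F : Series r) e → Extensional (powS F e)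
powS-extensional F zero    = mono-extensional _
powS-extensional F (suc e) = mulS-extensional F _ (powS-extensional F e)

prodS-extensional : ∀ {r s} (f : Fin s → Series r) → Extensional (prodS f)
prodS-extensional {s = zero}  f = mono-extensional _
prodS-extensional {s = suc s} f = mulS-extensional (head f) _ (prodS-extensional (tail f))

powS-cong : ∀ {r} {F G : Series r} → F ≗ G → ∀ e → powS F e ≗ powS G e
powS-cong F≗G zero    n = refl
powS-cong F≗G (suc e) = mulS-cong F≗G (powS-cong F≗G e)

prodS-cong : ∀ {r s} {f g : Fin s → Series r} → (∀ j → f j ≗ g j) → prodS f ≗ prodS g
prodS-cong {s = zero}  f≗g n = refl
prodS-cong {s = suc s} f≗g = mulS-cong (f≗g Fin.zero) (prodS-cong (f≗g ∘ Fin.suc))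

-- Tensor products of one-variable series

δ : ℕ → ℤ
δ zero    = 1ℤ
δ (suc _) = 0ℤ

conv : (ℕ → ℤ) → (ℕ → ℤ) → ℕ → ℤ
conv g h a = sumUpTo a (λ i → g i * h (a ∸ i))

convPow : (ℕ → ℤ) → ℕ → ℕ → ℤ
convPow h zero    = δ
convPow h (suc e) = conv h (convPow h e)

convProd : ∀ {s} → (Fin s → ℕ → ℤ) → ℕ → ℤ
convProd {zero}  hs = δ
convProd {suc s} hs = conv (head hs) (convProd (tail hs))

conv-cong : ∀ {g g′ h h′ : ℕ → ℤ} → g ≗ g′ → h ≗ h′ → conv g h ≗ conv g′ h′
conv-cong g≗g′ h≗h′ a = sumUpTo-cong a (λ i _ → cong₂ _*_ (g≗g′ i) (h≗h′ _))

conv-congʳ : ∀ (g : ℕ → ℤ) {h h′ : ℕ → ℤ} → h ≗ h′ → conv g h ≗ conv g h′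
conv-congʳ g = conv-cong {g = g} (λ _ → refl)

conv-zeroˡ : ∀ (g h : ℕ → ℤ) a → (∀ i → i ≤ a → g i ≡ 0ℤ) → conv g h a ≡ 0ℤ
conv-zeroˡ g h a g≡0 = sumUpTo-zero a (λ i i≤a → cong (_* h (a ∸ i)) (g≡0 i i≤a))

∸-suc : ∀ {a i} → i ≤ a → suc a ∸ i ≡ suc (a ∸ i)
∸-suc = ℕₚ.+-∸-assoc 1

conv-identityˡ : ∀ (h : ℕ → ℤ) → conv δ h ≗ h
conv-identityˡ h zero    = ℤₚ.*-identityˡ (h 0)
conv-identityˡ h (suc a) = begin
  conv δ h (suc a)
    ≡⟨ sumUpTo-suc a _ ⟩
  1ℤ * h (suc a) + sumUpTo a (λ i → 0ℤ * h (a ∸ i))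
    ≡⟨ cong₂ _+_ (ℤₚ.*-identityˡ (h (suc a))) (sumUpTo-zero a {λ i → 0ℤ * h (a ∸ i)} (λ _ _ → refl)) ⟩
  h (suc a) + 0ℤ
    ≡⟨ ℤₚ.+-identityʳ _ ⟩
  h (suc a) ∎
  where open ≡-Reasoning

conv-identityʳ : ∀ (h : ℕ → ℤ) → conv h δ ≗ h
conv-identityʳ h zero    = ℤₚ.*-identityʳ (h 0)
conv-identityʳ h (suc a) = begin
  conv h δ (suc a)
    ≡⟨ cong₂ _+_ (sumUpTo-zero a off-diagonal) (cong (λ t → h (suc a) * δ t) (ℕₚ.n∸n≡0 a)) ⟩
  0ℤ + h (suc a) * 1ℤ
    ≡⟨ trans (ℤₚ.+-identityˡ _) (ℤₚ.*-identityʳ _) ⟩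
  h (suc a) ∎
  where
  open ≡-Reasoning
  off-diagonal : ∀ i → i ≤ a → h i * δ (suc a ∸ i) ≡ 0ℤ
  off-diagonal i i≤a = trans (cong (λ t → h i * δ t) (∸-suc i≤a)) (ℤₚ.*-zeroʳ (h i))

convPow-δ : ∀ e → convPow δ e ≗ δ
convPow-δ zero    a = refl
convPow-δ (suc e) a = trans (conv-congʳ δ (convPow-δ e) a) (conv-identityˡ δ a)

convProd-δ : ∀ {s} (hs : Fin s → ℕ → ℤ) → (∀ j → hs j ≗ δ) → convProd hs ≗ δ
convProd-δ {zero}  hs hs≗δ a = refl
convProd-δ {suc s} hs hs≗δ a =
  trans (conv-cong (hs≗δ Fin.zero) (convProd-δ (tail hs) (hs≗δ ∘ Fin.suc)) a) (conv-identityˡ δ a)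

tensor : ∀ {r} → (Fin r → ℕ → ℤ) → Series r
tensor {zero}  h n = 1ℤ
tensor {suc r} h n = head h (head n) * tensor (tail h) (tail n)

tensor-cong : ∀ {r} {g h : Fin r → ℕ → ℤ} → (∀ i → g i ≗ h i) → tensor g ≗ tensor h
tensor-cong {zero}  g≗h n = refl
tensor-cong {suc r} g≗h n = cong₂ _*_ (g≗h Fin.zero _) (tensor-cong (g≗h ∘ Fin.suc) _)

mulS-tensor : ∀ {r} (g h : Fin r → ℕ → ℤ) → mulS (tensor g) (tensor h) ≗ tensor (λ i → conv (g i) (h i))
mulS-tensor {zero}  g h n = refl
mulS-tensor {suc r} g h n = begin
  mulS (tensor g) (tensor h) n
    ≡⟨ sumUpTo-cong n₀ (λ i _ → trans (boxSum-cong n′ (λ m → interchange (head g i) (tensor (tail g) m) _ _))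
                                      (sym (*-distribˡ-boxSum n′ _ (head g i * head h (n₀ ∸ i))))) ⟩
  sumUpTo n₀ (λ i → (head g i * head h (n₀ ∸ i)) * mulS (tensor (tail g)) (tensor (tail h)) n′)
    ≡⟨ sym (*-distribʳ-sumUpTo n₀ _ _) ⟩
  conv (head g) (head h) n₀ * mulS (tensor (tail g)) (tensor (tail h)) n′
    ≡⟨ cong (conv (head g) (head h) n₀ *_) (mulS-tensor (tail g) (tail h) n′) ⟩
  tensor (λ i → conv (g i) (h i)) n ∎
  where
  open ≡-Reasoning
  n₀ = head n
  n′ = tail n

oneS-tensor : ∀ {r} → oneS {r} ≗ tensor (λ _ → δ)
oneS-tensor {zero}  n = refl
oneS-tensor {suc r} n with head n
... | zero  = trans (sym (ℤₚ.*-identityˡ _)) (cong (1ℤ *_) (oneS-tensor (tail n)))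
... | suc _ = refl

powS-tensor : ∀ {r} (h : Fin r → ℕ → ℤ) e → powS (tensor h) e ≗ tensor (λ i → convPow (h i) e)
powS-tensor h zero    = oneS-tensor
powS-tensor h (suc e) n = trans (mulS-congʳ (tensor h) (powS-tensor h e) n) (mulS-tensor h _ n)

prodS-tensor : ∀ {r s} (H : Fin s → Fin r → ℕ → ℤ) →
               prodS (λ j → tensor (H j)) ≗ tensor (λ i → convProd (λ j → H j i))
prodS-tensor {s = zero}  H = oneS-tensor
prodS-tensor {s = suc s} H n =
  trans (mulS-congʳ (tensor (head H)) (prodS-tensor (tail H)) n) (mulS-tensor (head H) _ n)

oneMinusX : ℕ → ℤ
oneMinusX zero          = 1ℤ
oneMinusX (suc zero)    = -1ℤ
oneMinusX (suc (suc _)) = 0ℤ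

oneMinusXPow : ℕ → ℕ → ℤ
oneMinusXPow = convPow oneMinusX

-- 1 − xⱼ is the tensor product over i of oneMinusVar j i.
oneMinusVar : ∀ {r} → Fin r → Fin r → ℕ → ℤ
oneMinusVar Fin.zero    Fin.zero    = oneMinusX
oneMinusVar Fin.zero    (Fin.suc i) = δ
oneMinusVar (Fin.suc j) Fin.zero    = δ
oneMinusVar (Fin.suc j) (Fin.suc i) = oneMinusVar j i

oneS-varS-tensor : ∀ {r} (j : Fin r) → subS oneS (varS j) ≗ tensor (oneMinusVar j)
oneS-varS-tensor {suc r} Fin.zero n =
  trans (split (head n) (eqIdx (λ _ → 0) (tail n))) (cong (oneMinusX (head n) *_) (oneS-tensor (tail n)))
  where
  split : ∀ n₀ E → guard ((0 ≡ᵇ n₀) ∧ E) 1ℤ - guard ((1 ≡ᵇ n₀) ∧ E) 1ℤ ≡ oneMinusX n₀ * guard E 1ℤ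
  split zero          true  = refl
  split zero          false = refl
  split (suc zero)    true  = refl
  split (suc zero)    false = refl
  split (suc (suc _)) true  = refl
  split (suc (suc _)) false = refl
oneS-varS-tensor {suc r} (Fin.suc j) n =
  trans (split (head n) _ _) (cong (δ (head n) *_) (oneS-varS-tensor j (tail n)))
  where
  split : ∀ n₀ A B → guard ((0 ≡ᵇ n₀) ∧ A) 1ℤ - guard ((0 ≡ᵇ n₀) ∧ B) 1ℤ ≡ δ n₀ * (guard A 1ℤ - guard B 1ℤ)
  split zero    A B = sym (ℤₚ.*-identityˡ _)
  split (suc _) A B = refl

convProd-oneMinusVar : ∀ {s} (i : Fin s) (e : Fin s → ℕ) →
                       convProd (λ j → convPow (oneMinusVar j i) (e j)) ≗ oneMinusXPow (e i)
convProd-oneMinusVar Fin.zero e a =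
  trans (conv-congʳ (oneMinusXPow (head e)) (convProd-δ (tail hs) (convPow-δ ∘ e ∘ Fin.suc)) a)
        (conv-identityʳ (oneMinusXPow (head e)) a)
  where
  hs = λ j → convPow (oneMinusVar j Fin.zero) (e j)
convProd-oneMinusVar (Fin.suc i) e a =
  trans (conv-cong (convPow-δ (head e)) (convProd-oneMinusVar i (tail e)) a)
        (conv-identityˡ (oneMinusXPow (e (Fin.suc i))) a)

denominator : ∀ {r} → (Fin r → ℕ) → Series r
denominator k = prodS (λ j → powS (subS oneS (varS j)) (expo k j))

denominator-extensional : ∀ {r} (k : Fin r → ℕ) → Extensional (denominator k)
denominator-extensional k = prodS-extensional (λ j → powS (subS oneS (varS j)) (expo k j))

denominator-tensor : ∀ {r} (k : Fin r → ℕ) → denominator k ≗ tensor (λ i → oneMinusXPow (expo k i))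
denominator-tensor k n = begin
  denominator k n
    ≡⟨ prodS-cong (λ j → powS-cong (oneS-varS-tensor j) (expo k j)) n ⟩
  prodS (λ j → powS (tensor (oneMinusVar j)) (expo k j)) n
    ≡⟨ prodS-cong (λ j → powS-tensor (oneMinusVar j) (expo k j)) n ⟩
  prodS (λ j → tensor (λ i → convPow (oneMinusVar j i) (expo k j))) n
    ≡⟨ prodS-tensor (λ j i → convPow (oneMinusVar j i) (expo k j)) n ⟩
  tensor (λ i → convProd (λ j → convPow (oneMinusVar j i) (expo k j))) n
    ≡⟨ tensor-cong (λ i → convProd-oneMinusVar i (expo k)) n ⟩
  tensor (λ i → oneMinusXPow (expo k i)) n ∎
  where open ≡-Reasoning

-- Polynomial sequences

Δ : (ℕ → ℤ) → ℕ → ℤ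
Δ f x = f (suc x) - f x

Δ^ : ℕ → (ℕ → ℤ) → ℕ → ℤ
Δ^ zero    f = f
Δ^ (suc n) f = Δ^ n (Δ f)

Δ^-suc : ∀ n (f : ℕ → ℤ) → Δ^ (suc n) f ≗ Δ (Δ^ n f)
Δ^-suc zero    f x = refl
Δ^-suc (suc n) f x = Δ^-suc n (Δ f) x

-- A record rather than a function into Set, so that f can be inferred from the type.
record Polynomial (d : ℕ) (f : ℕ → ℤ) : Set where
  constructor polynomial
  field Δ^-vanishes : ∀ x → Δ^ (suc d) f x ≡ 0ℤ
open Polynomial

Δ-polynomial : ∀ {d f} → Polynomial (suc d) f → Polynomial d (Δ f)
Δ-polynomial p = polynomial (Δ^-vanishes p)

polynomial-Δ : ∀ {d f} → Polynomial d (Δ f) → Polynomial (suc d) f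
polynomial-Δ p = polynomial (Δ^-vanishes p)

Δ-cong : ∀ {f g : ℕ → ℤ} → f ≗ g → Δ f ≗ Δ g
Δ-cong f≗g x = cong₂ _-_ (f≗g (suc x)) (f≗g x)

Polynomial-resp : ∀ d {f g : ℕ → ℤ} → f ≗ g → Polynomial d f → Polynomial d g
Polynomial-resp zero    f≗g p = polynomial (λ x → trans (sym (Δ-cong f≗g x)) (Δ^-vanishes p x))
Polynomial-resp (suc d) f≗g p = polynomial-Δ (Polynomial-resp d (Δ-cong f≗g) (Δ-polynomial p))

Polynomial-const : ∀ d c → Polynomial d (λ _ → c)
Polynomial-const zero    c = polynomial (λ _ → ℤₚ.+-inverseʳ c)
Polynomial-const (suc d) c = polynomial-Δ (Polynomial-resp d (λ _ → sym (ℤₚ.+-inverseʳ c)) (Polynomial-const d 0ℤ))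

Polynomial-zero : ∀ d {f : ℕ → ℤ} → (∀ x → f x ≡ 0ℤ) → Polynomial d f
Polynomial-zero d f≡0 = Polynomial-resp d (sym ∘ f≡0) (Polynomial-const d 0ℤ)

Polynomial-suc : ∀ d {f : ℕ → ℤ} → Polynomial d f → Polynomial d (f ∘ suc)
Polynomial-suc zero    p = polynomial (Δ^-vanishes p ∘ suc)
Polynomial-suc (suc d) p = polynomial-Δ (Polynomial-suc d (Δ-polynomial p))

Polynomial-shift : ∀ d c {f : ℕ → ℤ} → Polynomial d f → Polynomial d (λ x → f (x ℕ.+ c))
Polynomial-shift d zero    {f} p = Polynomial-resp d (λ x → cong f (sym (ℕₚ.+-identityʳ x))) p
Polynomial-shift d (suc c) {f} p =
  Polynomial-resp d (λ x → cong f (sym (ℕₚ.+-suc x c))) (Polynomial-shift d c (Polynomial-suc d p))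

Δ-+ : ∀ (f g : ℕ → ℤ) x → Δ (λ y → f y + g y) x ≡ Δ f x + Δ g x
Δ-+ f g x = regroup (f (suc x)) (g (suc x)) (f x) (g x)
  where
  regroup : ∀ a b c d → a + b - (c + d) ≡ (a - c) + (b - d)
  regroup = solve-∀

Polynomial-+ : ∀ d {f g : ℕ → ℤ} → Polynomial d f → Polynomial d g → Polynomial d (λ x → f x + g x)
Polynomial-+ zero    {f} {g} p q =
  polynomial (λ x → trans (Δ-+ f g x) (cong₂ _+_ (Δ^-vanishes p x) (Δ^-vanishes q x)))
Polynomial-+ (suc d) {f} {g} p q =
  polynomial-Δ (Polynomial-resp d (sym ∘ Δ-+ f g) (Polynomial-+ d (Δ-polynomial p) (Δ-polynomial q)))

Δ-* : ∀ (f g : ℕ → ℤ) x → Δ (λ y → f y * g y) x ≡ f (suc x) * Δ g x + Δ f x * g x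
Δ-* f g x = leibniz (f (suc x)) (g (suc x)) (f x) (g x)
  where
  leibniz : ∀ a b c d → a * b - c * d ≡ a * (b - d) + (a - c) * d
  leibniz = solve-∀

Polynomial-Δ-* : ∀ n (f g : ℕ → ℤ) → Polynomial n (λ x → f (suc x) * Δ g x) →
                 Polynomial n (λ x → Δ f x * g x) → Polynomial (suc n) (λ x → f x * g x)
Polynomial-Δ-* n f g p q = polynomial-Δ (Polynomial-resp n (sym ∘ Δ-* f g) (Polynomial-+ n p q))

Polynomial-* : ∀ d e {f g : ℕ → ℤ} → Polynomial d f → Polynomial e g → Polynomial (d ℕ.+ e) (λ x → f x * g x)
Polynomial-* zero zero {f} {g} p q = polynomial (λ x → begin
  Δ (λ y → f y * g y) x               ≡⟨ Δ-* f g x ⟩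
  f (suc x) * Δ g x + Δ f x * g x     ≡⟨ cong₂ (λ s t → f (suc x) * s + t * g x) (Δ^-vanishes q x) (Δ^-vanishes p x) ⟩
  f (suc x) * 0ℤ + 0ℤ                 ≡⟨ cong (_+ 0ℤ) (ℤₚ.*-zeroʳ (f (suc x))) ⟩
  0ℤ                                  ∎)
  where open ≡-Reasoning
Polynomial-* zero (suc e) {f} {g} p q =
  Polynomial-Δ-* e f g (Polynomial-* zero e (Polynomial-suc zero p) (Δ-polynomial q))
                       (Polynomial-zero e (λ x → cong (_* g x) (Δ^-vanishes p x)))
Polynomial-* (suc d) zero {f} {g} p q =
  Polynomial-Δ-* (d ℕ.+ 0) f g
    (Polynomial-zero (d ℕ.+ 0) (λ x → trans (cong (f (suc x) *_) (Δ^-vanishes q x)) (ℤₚ.*-zeroʳ (f (suc x)))))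
    (Polynomial-* d zero (Δ-polynomial p) q)
Polynomial-* (suc d) (suc e) {f} {g} p q =
  Polynomial-Δ-* (d ℕ.+ suc e) f g
    (subst (λ n → Polynomial n (λ x → f (suc x) * Δ g x)) (sym (ℕₚ.+-suc d e))
           (Polynomial-* (suc d) e (Polynomial-suc (suc d) p) (Δ-polynomial q)))
    (Polynomial-* d (suc e) (Δ-polynomial p) q)

Polynomial-*ᶜ : ∀ d c {f : ℕ → ℤ} → Polynomial d f → Polynomial d (λ x → f x * c)
Polynomial-*ᶜ d c p = subst (λ n → Polynomial n _) (ℕₚ.+-identityʳ d) (Polynomial-* d 0 p (Polynomial-const 0 c))

Polynomial-sumUpTo : ∀ d N (G : ℕ → ℕ → ℤ) → (∀ i → Polynomial d (λ x → G x i)) →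
                     Polynomial d (λ x → sumUpTo N (G x))
Polynomial-sumUpTo d zero    G p = p 0
Polynomial-sumUpTo d (suc N) G p = Polynomial-+ d (Polynomial-sumUpTo d N G p) (p (suc N))

Polynomial-^ : ∀ k → Polynomial k (λ x → + (x ℕ.^ k))
Polynomial-^ zero    = Polynomial-const 0 1ℤ
Polynomial-^ (suc k) =
  Polynomial-resp (suc k) (λ x → sym (ℤₚ.pos-* x (x ℕ.^ k))) (Polynomial-* 1 k identity (Polynomial-^ k))
  where
  unit-step : ∀ a → 1ℤ + a - a ≡ 1ℤ
  unit-step = solve-∀
  identity : Polynomial 1 (λ x → + x)
  identity = polynomial-Δ (Polynomial-resp 0 (λ x → sym (unit-step (+ x))) (Polynomial-const 0 1ℤ))

oneMinusX-conv-suc : ∀ (h : ℕ → ℤ) t → conv oneMinusX h (suc t) ≡ h (suc t) - h t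
oneMinusX-conv-suc h zero    = difference (h 1) (h 0)
  where
  difference : ∀ a b → 1ℤ * a + -1ℤ * b ≡ a - b
  difference = solve-∀
oneMinusX-conv-suc h (suc t) = begin
  conv oneMinusX h (2 ℕ.+ t)
    ≡⟨ sumUpTo-suc (suc t) _ ⟩
  1ℤ * h (2 ℕ.+ t) + sumUpTo (suc t) (λ i → oneMinusX (suc i) * h (suc t ∸ i))
    ≡⟨ cong (λ s → 1ℤ * h (2 ℕ.+ t) + s) (sumUpTo-suc t _) ⟩
  1ℤ * h (2 ℕ.+ t) + (-1ℤ * h (suc t) + sumUpTo t (λ i → 0ℤ * h (t ∸ i)))
    ≡⟨ cong (λ s → 1ℤ * h (2 ℕ.+ t) + (-1ℤ * h (suc t) + s)) (sumUpTo-zero t (λ _ _ → refl)) ⟩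
  1ℤ * h (2 ℕ.+ t) + (-1ℤ * h (suc t) + 0ℤ)
    ≡⟨ difference (h (2 ℕ.+ t)) (h (suc t)) ⟩
  h (2 ℕ.+ t) - h (suc t) ∎
  where
  open ≡-Reasoning
  difference : ∀ a b → 1ℤ * a + (-1ℤ * b + 0ℤ) ≡ a - b
  difference = solve-∀

conv-oneMinusX-conv-suc : ∀ (g h : ℕ → ℤ) a →
                          conv g (conv oneMinusX h) (suc a) ≡ conv g h (suc a) - conv g h a
conv-oneMinusX-conv-suc g h a = begin
  sumUpTo a (λ i → g i * h′ (suc a ∸ i)) + g (suc a) * h′ (a ∸ a)
    ≡⟨ cong₂ _+_ (sumUpTo-cong a inner) (cong (g (suc a) *_) last) ⟩
  sumUpTo a (λ i → g i * h (suc a ∸ i) - g i * h (a ∸ i)) + g (suc a) * h (a ∸ a)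
    ≡⟨ cong (_+ g (suc a) * h (a ∸ a)) (sumUpTo-sub a _ _) ⟩
  sumUpTo a (λ i → g i * h (suc a ∸ i)) - conv g h a + g (suc a) * h (a ∸ a)
    ≡⟨ regroup (sumUpTo a (λ i → g i * h (suc a ∸ i))) (conv g h a) (g (suc a) * h (a ∸ a)) ⟩
  conv g h (suc a) - conv g h a ∎
  where
  open ≡-Reasoning
  distrib : ∀ x y z → x * (y - z) ≡ x * y - x * z
  distrib = solve-∀
  regroup : ∀ x y z → x - y + z ≡ x + z - y
  regroup = solve-∀
  h′ = conv oneMinusX h
  last : h′ (a ∸ a) ≡ h (a ∸ a)
  last rewrite ℕₚ.n∸n≡0 a = ℤₚ.*-identityˡ (h 0)
  inner : ∀ i → i ≤ a → g i * h′ (suc a ∸ i) ≡ g i * h (suc a ∸ i) - g i * h (a ∸ i)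
  inner i i≤a rewrite ∸-suc i≤a =
    trans (cong (g i *_) (oneMinusX-conv-suc h (a ∸ i))) (distrib (g i) _ _)

conv-oneMinusXPow≡Δ^ : ∀ (g : ℕ → ℤ) n b → conv g (oneMinusXPow n) (suc (n ℕ.+ b)) ≡ Δ^ n (g ∘ suc) b
conv-oneMinusXPow≡Δ^ g zero    b = conv-identityʳ g (suc b)
conv-oneMinusXPow≡Δ^ g (suc n) b = begin
  conv g (oneMinusXPow (suc n)) (2 ℕ.+ (n ℕ.+ b))
    ≡⟨ conv-oneMinusX-conv-suc g (oneMinusXPow n) (suc (n ℕ.+ b)) ⟩
  conv g (oneMinusXPow n) (2 ℕ.+ (n ℕ.+ b)) - conv g (oneMinusXPow n) (suc (n ℕ.+ b))
    ≡⟨ cong₂ _-_ (trans (cong (conv g (oneMinusXPow n) ∘ suc) (sym (ℕₚ.+-suc n b))) (conv-oneMinusXPow≡Δ^ g n (suc b)))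
                 (conv-oneMinusXPow≡Δ^ g n b) ⟩
  Δ (Δ^ n (g ∘ suc)) b
    ≡⟨ sym (Δ^-suc n (g ∘ suc) b) ⟩
  Δ^ (suc n) (g ∘ suc) b ∎
  where open ≡-Reasoning

conv-oneMinusXPow-vanishes : ∀ d (g : ℕ → ℤ) → Polynomial d (g ∘ suc) →
                             ∀ a → suc d < a → conv g (oneMinusXPow (suc d)) a ≡ 0ℤ
conv-oneMinusXPow-vanishes d g p a d+1<a = begin
  conv g (oneMinusXPow (suc d)) a
    ≡⟨ cong (conv g (oneMinusXPow (suc d))) (sym (ℕₚ.m+[n∸m]≡n d+1<a)) ⟩
  conv g (oneMinusXPow (suc d)) (suc (suc d ℕ.+ (a ∸ suc (suc d))))
    ≡⟨ conv-oneMinusXPow≡Δ^ g (suc d) (a ∸ suc (suc d)) ⟩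
  Δ^ (suc d) (g ∘ suc) (a ∸ suc (suc d))
    ≡⟨ Δ^-vanishes p _ ⟩
  0ℤ ∎
  where open ≡-Reasoning

-- The numerator in the variables y

-- Li^ш with all partial sums l₁ + ⋯ + lⱼ shifted by acc.
LiShFrom : ∀ {r} → ℕ → (Fin r → ℕ) → Series r
LiShFrom acc k l = + liShGo acc k l

numerator : ∀ {r} → ℕ → (Fin r → ℕ) → Series r
numerator acc k = mulS (LiShFrom acc k) (tensor (λ i → oneMinusXPow (expo k i)))

weightedNumerator : ∀ {r} → (Fin (suc r) → ℕ) → MultiIdx r → ℕ → ℤ
weightedNumerator k n′ s = + (s ℕ.^ head k) * numerator s (tail k) n′

numeratorSummand : ∀ {r} → ℕ → (Fin (suc r) → ℕ) → MultiIdx r → ℕ → ℤ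
numeratorSummand acc k n′ zero    = 0ℤ
numeratorSummand acc k n′ (suc i) = weightedNumerator k n′ (acc ℕ.+ suc i)

numerator-cons : ∀ {r} acc (k : Fin (suc r) → ℕ) n →
                 numerator acc k n ≡ conv (numeratorSummand acc k (tail n)) (oneMinusXPow (expo k Fin.zero)) (head n)
numerator-cons {r} acc k n = sumUpTo-cong (head n) summand
  where
  c = oneMinusXPow (expo k Fin.zero)
  T′ : MultiIdx r → ℤ
  T′ m = tensor (λ i → oneMinusXPow (expo (tail k) i)) (λ j → tail n j ∸ m j)
  summand : ∀ i → i ≤ head n →
            boxSum (tail n) (λ m → LiShFrom acc k (i ∷ m) * (c (head n ∸ i) * T′ m))
            ≡ numeratorSummand acc k (tail n) i * c (head n ∸ i)
  summand zero    _ = boxSum-zero (tail n) (λ _ → refl)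
  summand (suc i) _ = begin
    boxSum (tail n) (λ m → + (A ℕ.* liShGo a (tail k) m) * (C * T′ m))
      ≡⟨ boxSum-cong (tail n) (λ m → trans (cong (_* (C * T′ m)) (ℤₚ.pos-* A (liShGo a (tail k) m)))
                                           (interchange (+ A) (+ liShGo a (tail k) m) C (T′ m))) ⟩
    boxSum (tail n) (λ m → (+ A * C) * (LiShFrom a (tail k) m * T′ m))
      ≡⟨ sym (*-distribˡ-boxSum (tail n) (λ m → LiShFrom a (tail k) m * T′ m) (+ A * C)) ⟩
    (+ A * C) * numerator a (tail k) (tail n)
      ≡⟨ swap (+ A) C (numerator a (tail k) (tail n)) ⟩
    (+ A * numerator a (tail k) (tail n)) * C ∎
    where
    open ≡-Reasoning
    a = acc ℕ.+ suc i
    A = a ℕ.^ head k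
    C = c (head n ∸ suc i)
    swap : ∀ x y z → (x * y) * z ≡ (x * z) * y
    swap = solve-∀

numerator-polynomial : ∀ {r} (k : Fin r → ℕ) n → Polynomial (sumF k) (λ acc → numerator acc k n)

weightedNumerator-polynomial : ∀ {r} (k : Fin (suc r) → ℕ) n′ → Polynomial (sumF k) (weightedNumerator k n′)
weightedNumerator-polynomial k n′ =
  Polynomial-* (head k) (sumF (tail k)) (Polynomial-^ (head k)) (numerator-polynomial (tail k) n′)

numerator-polynomial {zero}  k n = Polynomial-const 0 (numerator 0 k n)
numerator-polynomial {suc r} k n =
  Polynomial-resp (sumF k) (λ acc → sym (numerator-cons acc k n)) (Polynomial-sumUpTo (sumF k) (head n) _ summand)
  where
  summand : ∀ i → Polynomial (sumF k)
                    (λ acc → numeratorSummand acc k (tail n) i * oneMinusXPow (expo k Fin.zero) (head n ∸ i))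
  summand zero    = Polynomial-zero (sumF k) (λ _ → refl)
  summand (suc i) = Polynomial-*ᶜ (sumF k) (oneMinusXPow (expo k Fin.zero) (head n ∸ suc i))
                      (Polynomial-shift (sumF k) (suc i) (weightedNumerator-polynomial k (tail n)))

numerator-cons-vanishes : ∀ {r} acc (k : Fin (suc r) → ℕ) n →
                          (∀ acc′ → numerator acc′ (tail k) (tail n) ≡ 0ℤ) → numerator acc k n ≡ 0ℤ
numerator-cons-vanishes acc k n tail≡0 =
  trans (numerator-cons acc k n) (conv-zeroˡ G (oneMinusXPow (expo k Fin.zero)) (head n) G≡0)
  where
  G = numeratorSummand acc k (tail n)
  G≡0 : ∀ i → i ≤ head n → G i ≡ 0ℤ
  G≡0 zero    _ = refl
  G≡0 (suc i) _ = trans (cong (w *_) (tail≡0 (acc ℕ.+ suc i))) (ℤₚ.*-zeroʳ w)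
    where w = + ((acc ℕ.+ suc i) ℕ.^ head k)

numerator-vanishes : ∀ {r} (k : Fin r → ℕ) n (j : Fin r) acc → n j ≡ 0 → numerator acc k n ≡ 0ℤ
numerator-vanishes {suc r} k n Fin.zero    acc n₀≡0 =
  -- the convolution at 0 is numeratorSummand … 0 * c 0 = 0 by computation
  trans (numerator-cons acc k n) (cong (conv (numeratorSummand acc k (tail n)) (oneMinusXPow (expo k Fin.zero))) n₀≡0)
numerator-vanishes {suc r} k n (Fin.suc j) acc nⱼ≡0 =
  numerator-cons-vanishes acc k n (λ acc′ → numerator-vanishes (tail k) (tail n) j acc′ nⱼ≡0)

numerator-degree : ∀ {r} (k : Fin r → ℕ) n (j : Fin r) acc → expo k j < n j → numerator acc k n ≡ 0ℤ
numerator-degree {suc r} k n (Fin.suc j) acc e<nⱼ =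
  numerator-cons-vanishes acc k n (λ acc′ → numerator-degree (tail k) (tail n) j acc′ e<nⱼ)
numerator-degree {suc r} k n Fin.zero acc e<n₀ = begin
  numerator acc k n
    ≡⟨ numerator-cons acc k n ⟩
  conv G (oneMinusXPow (expo k Fin.zero)) (head n)
    ≡⟨ cong (λ e → conv G (oneMinusXPow e) (head n)) expo≡suc ⟩
  conv G (oneMinusXPow (suc (sumF k))) (head n)
    ≡⟨ conv-oneMinusXPow-vanishes (sumF k) G G-polynomial (head n) (subst (_< head n) expo≡suc e<n₀) ⟩
  0ℤ ∎
  where
  open ≡-Reasoning
  G = numeratorSummand acc k (tail n)
  expo≡suc : expo k Fin.zero ≡ suc (sumF k)
  expo≡suc = ℕₚ.+-comm (sumF k) 1
  G-polynomial : Polynomial (sumF k) (G ∘ suc)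
  G-polynomial =
    Polynomial-resp (sumF k)
      (λ x → cong (weightedNumerator k (tail n)) (trans (ℕₚ.+-comm x (suc acc)) (sym (ℕₚ.+-suc acc x))))
      (Polynomial-shift (sumF k) (suc acc) (weightedNumerator-polynomial k (tail n)))

-- The substitution yⱼ = zⱼ ⋯ z_r

-- substFrom p is substY on the tail of a z-index whose partial sums have already reached p.
substFrom : ∀ {r} → ℕ → Series r → Series r
substFrom p F m = maybe′ F 0ℤ (decodeGo p m)

substY≗substFrom : ∀ {r} (P : Series r) → substY P ≗ substFrom 0 P
substY≗substFrom P m with decodeGo 0 m
... | just l  = refl
... | nothing = refl

substFrom-cons : ∀ {r} p (F : Series (suc r)) m →
                 substFrom p F m ≡ guard (p ≤ᵇ head m) (substFrom (head m) (F ∘ ((head m ∸ p) ∷_)) (tail m))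
substFrom-cons p F m with p ≤ᵇ head m | decodeGo (head m) (tail m)
... | true  | just l  = refl
... | true  | nothing = refl
... | false | _       = refl

substFrom-cong : ∀ {r} p {F G : Series r} → F ≗ G → substFrom p F ≗ substFrom p G
substFrom-cong p F≗G m with decodeGo p m
... | just l  = F≗G l
... | nothing = refl

substFrom-zero : ∀ {r} p {F : Series r} → (∀ l → F l ≡ 0ℤ) → ∀ m → substFrom p F m ≡ 0ℤ
substFrom-zero p F≡0 m with decodeGo p m
... | just l  = F≡0 l
... | nothing = refl

substFrom-sumUpTo : ∀ {r} p N (H : ℕ → Series r) m →
                    substFrom p (λ l → sumUpTo N (λ j → H j l)) m ≡ sumUpTo N (λ j → substFrom p (H j) m)
substFrom-sumUpTo p N H m with decodeGo p m
... | just l  = refl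
... | nothing = sym (sumUpTo-zero N (λ _ _ → refl))

substFrom-*ˡ : ∀ {r} p c (F : Series r) m → substFrom p (λ l → c * F l) m ≡ c * substFrom p F m
substFrom-*ˡ p c F m with decodeGo p m
... | just l  = refl
... | nothing = sym (ℤₚ.*-zeroʳ c)

substFrom-subS : ∀ {r} p (F G : Series r) → substFrom p (subS F G) ≗ subS (substFrom p F) (substFrom p G)
substFrom-subS p F G m with decodeGo p m
... | just l  = refl
... | nothing = refl

Extensional-∷ : ∀ {r} (G : Series (suc r)) → Extensional G → ∀ a → Extensional (G ∘ (a ∷_))
Extensional-∷ G G-ext a l≗l′ = G-ext λ { Fin.zero → refl ; (Fin.suc x) → l≗l′ x }

mulS-cons : ∀ {r} (F G : Series (suc r)) → Extensional G → ∀ a l →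
            mulS F G (a ∷ l) ≡ sumUpTo a (λ j → mulS (F ∘ (j ∷_)) (G ∘ ((a ∸ j) ∷_)) l)
mulS-cons F G G-ext a l =
  sumUpTo-cong a (λ j _ → boxSum-cong l (λ m → cong (F (j ∷ m) *_) (G-ext λ { Fin.zero → refl ; (Fin.suc x) → refl })))

sumUpTo-guard-shift : ∀ p N (Y : ℕ → ℤ) →
                      sumUpTo N (λ i → guard (p ≤ᵇ i) (Y (i ∸ p))) ≡ guard (p ≤ᵇ N) (sumUpTo (N ∸ p) Y)
sumUpTo-guard-shift zero    N       Y = refl
sumUpTo-guard-shift (suc p) zero    Y = refl
sumUpTo-guard-shift (suc p) (suc N) Y = begin
  sumUpTo (suc N) (λ i → guard (suc p ≤ᵇ i) (Y (i ∸ suc p)))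
    ≡⟨ trans (sumUpTo-suc N _) (ℤₚ.+-identityˡ _) ⟩
  sumUpTo N (λ i → guard (suc p ≤ᵇ suc i) (Y (i ∸ p)))
    ≡⟨ sumUpTo-cong N (λ i _ → cong (λ b → guard b (Y (i ∸ p))) (≤ᵇ-suc p i)) ⟩
  sumUpTo N (λ i → guard (p ≤ᵇ i) (Y (i ∸ p)))
    ≡⟨ sumUpTo-guard-shift p N Y ⟩
  guard (p ≤ᵇ N) (sumUpTo (N ∸ p) Y)
    ≡⟨ cong (λ b → guard b (sumUpTo (N ∸ p) Y)) (≤ᵇ-suc p N) ⟨
  guard (suc p ≤ᵇ suc N) (sumUpTo (N ∸ p) Y) ∎
  where open ≡-Reasoning

sumUpTo-guard-truncate : ∀ q N (Z : ℕ → ℤ) →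
                         sumUpTo N (λ i → guard (q ≤ᵇ N ∸ i) (Z i)) ≡ guard (q ≤ᵇ N) (sumUpTo (N ∸ q) Z)
sumUpTo-guard-truncate zero    N       Z = refl
sumUpTo-guard-truncate (suc q) zero    Z = refl
sumUpTo-guard-truncate (suc q) (suc N) Z = begin
  sumUpTo N (λ i → guard (suc q ≤ᵇ suc N ∸ i) (Z i)) + guard (suc q ≤ᵇ N ∸ N) (Z (suc N))
    ≡⟨ cong₂ _+_ (sumUpTo-cong N (λ i i≤N → cong (λ t → guard (suc q ≤ᵇ t) (Z i)) (∸-suc i≤N)))
                 (cong (λ t → guard (suc q ≤ᵇ t) (Z (suc N))) (ℕₚ.n∸n≡0 N)) ⟩
  sumUpTo N (λ i → guard (suc q ≤ᵇ suc (N ∸ i)) (Z i)) + 0ℤ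
    ≡⟨ ℤₚ.+-identityʳ _ ⟩
  sumUpTo N (λ i → guard (suc q ≤ᵇ suc (N ∸ i)) (Z i))
    ≡⟨ sumUpTo-cong N (λ i _ → cong (λ b → guard b (Z i)) (≤ᵇ-suc q (N ∸ i))) ⟩
  sumUpTo N (λ i → guard (q ≤ᵇ N ∸ i) (Z i))
    ≡⟨ sumUpTo-guard-truncate q N Z ⟩
  guard (q ≤ᵇ N) (sumUpTo (N ∸ q) Z)
    ≡⟨ cong (λ b → guard b (sumUpTo (N ∸ q) Z)) (≤ᵇ-suc q N) ⟨
  guard (suc q ≤ᵇ suc N) (sumUpTo (N ∸ q) Z) ∎
  where open ≡-Reasoning

guard-guard-∸ : ∀ p q N (S : ℤ) → guard (p ≤ᵇ N) (guard (q ≤ᵇ N ∸ p) S) ≡ guard (p ℕ.+ q ≤ᵇ N) S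
guard-guard-∸ zero    q N       S = refl
guard-guard-∸ (suc p) q zero    S = refl
guard-guard-∸ (suc p) q (suc N) S rewrite ≤ᵇ-suc p N | ≤ᵇ-suc (p ℕ.+ q) N = guard-guard-∸ p q N S

∸-comm : ∀ a t q → a ∸ t ∸ q ≡ a ∸ q ∸ t
∸-comm a t q = trans (ℕₚ.∸-+-assoc a t q) (trans (cong (a ∸_) (ℕₚ.+-comm t q)) (sym (ℕₚ.∸-+-assoc a q t)))

sumUpTo-guarded-antidiagonal :
  ∀ p q N (X : ℕ → ℕ → ℤ) →
  sumUpTo N (λ i → guard (p ≤ᵇ i) (guard (q ≤ᵇ N ∸ i) (X (i ∸ p) (N ∸ i ∸ q))))
  ≡ guard (p ℕ.+ q ≤ᵇ N) (sumUpTo (N ∸ (p ℕ.+ q)) (λ j → X j (N ∸ (p ℕ.+ q) ∸ j)))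
sumUpTo-guarded-antidiagonal p q N X = begin
  sumUpTo N (λ i → guard (p ≤ᵇ i) (guard (q ≤ᵇ N ∸ i) (X (i ∸ p) (N ∸ i ∸ q))))
    ≡⟨ sumUpTo-cong N shifted ⟩
  sumUpTo N (λ i → guard (p ≤ᵇ i) (Y (i ∸ p)))
    ≡⟨ sumUpTo-guard-shift p N Y ⟩
  guard (p ≤ᵇ N) (sumUpTo (N ∸ p) Y)
    ≡⟨ cong (guard (p ≤ᵇ N)) (sumUpTo-guard-truncate q (N ∸ p) (λ t → X t (N ∸ p ∸ t ∸ q))) ⟩
  guard (p ≤ᵇ N) (guard (q ≤ᵇ N ∸ p) (sumUpTo (N ∸ p ∸ q) (λ t → X t (N ∸ p ∸ t ∸ q))))
    ≡⟨ cong (guard (p ≤ᵇ N) ∘ guard (q ≤ᵇ N ∸ p)) reassociate ⟩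
  guard (p ≤ᵇ N) (guard (q ≤ᵇ N ∸ p) S)
    ≡⟨ guard-guard-∸ p q N S ⟩
  guard (p ℕ.+ q ≤ᵇ N) S ∎
  where
  open ≡-Reasoning
  Y : ℕ → ℤ
  Y t = guard (q ≤ᵇ N ∸ p ∸ t) (X t (N ∸ p ∸ t ∸ q))
  S = sumUpTo (N ∸ (p ℕ.+ q)) (λ j → X j (N ∸ (p ℕ.+ q) ∸ j))
  shifted : ∀ i → i ≤ N → guard (p ≤ᵇ i) (guard (q ≤ᵇ N ∸ i) (X (i ∸ p) (N ∸ i ∸ q))) ≡ guard (p ≤ᵇ i) (Y (i ∸ p))
  shifted i _ with p ≤ᵇ i in p≤ᵇi
  ... | false = refl
  ... | true  = cong (λ t → guard (q ≤ᵇ t) (X (i ∸ p) (t ∸ q)))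
                     (sym (trans (ℕₚ.∸-+-assoc N p (i ∸ p)) (cong (N ∸_) (ℕₚ.m+[n∸m]≡n (≤ᵇ≡true⇒≤ {p} p≤ᵇi)))))
  reassociate : sumUpTo (N ∸ p ∸ q) (λ t → X t (N ∸ p ∸ t ∸ q)) ≡ S
  reassociate rewrite ℕₚ.∸-+-assoc N p q =
    sumUpTo-cong (N ∸ (p ℕ.+ q)) (λ t _ → cong (X t) (trans (∸-comm (N ∸ p) t q) (cong (_∸ t) (ℕₚ.∸-+-assoc N p q))))

substFrom-mulS : ∀ {r} p q (F G : Series r) → Extensional G → ∀ n →
                 boxSum n (λ m → substFrom p F m * substFrom q G (λ j → n j ∸ m j)) ≡ substFrom (p ℕ.+ q) (mulS F G) n
substFrom-mulS {zero}  p q F G G-ext n = cong (F (λ ()) *_) (G-ext (λ ()))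
substFrom-mulS {suc r} p q F G G-ext n = begin
  sumUpTo n₀ (λ i → boxSum n′ (λ m → substFrom p F (i ∷ m) * substFrom q G (λ j → n j ∸ (i ∷ m) j)))
    ≡⟨ sumUpTo-cong n₀ column ⟩
  sumUpTo n₀ (λ i → guard (p ≤ᵇ i) (guard (q ≤ᵇ n₀ ∸ i) (X (i ∸ p) (n₀ ∸ i ∸ q))))
    ≡⟨ sumUpTo-guarded-antidiagonal p q n₀ X ⟩
  guard (p ℕ.+ q ≤ᵇ n₀) (sumUpTo A (λ j → X j (A ∸ j)))
    ≡⟨ cong (guard (p ℕ.+ q ≤ᵇ n₀))
            (trans (substFrom-cong n₀ (mulS-cons F G G-ext A) n′) (substFrom-sumUpTo n₀ A _ n′)) ⟨
  guard (p ℕ.+ q ≤ᵇ n₀) (substFrom n₀ (mulS F G ∘ (A ∷_)) n′)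
    ≡⟨ substFrom-cons (p ℕ.+ q) (mulS F G) n ⟨
  substFrom (p ℕ.+ q) (mulS F G) n ∎
  where
  open ≡-Reasoning
  n₀ = head n
  n′ = tail n
  A = n₀ ∸ (p ℕ.+ q)
  X : ℕ → ℕ → ℤ
  X a b = substFrom n₀ (mulS (F ∘ (a ∷_)) (G ∘ (b ∷_))) n′
  column : ∀ i → i ≤ n₀ →
           boxSum n′ (λ m → substFrom p F (i ∷ m) * substFrom q G (λ j → n j ∸ (i ∷ m) j))
           ≡ guard (p ≤ᵇ i) (guard (q ≤ᵇ n₀ ∸ i) (X (i ∸ p) (n₀ ∸ i ∸ q)))
  column i i≤n₀ =
    trans (boxSum-cong n′ (λ m → cong₂ _*_ (substFrom-cons p F (i ∷ m)) (substFrom-cons q G (λ j → n j ∸ (i ∷ m) j))))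
          (by-cases (p ≤ᵇ i) (q ≤ᵇ n₀ ∸ i))
    where
    F′ = F ∘ ((i ∸ p) ∷_)
    G′ = G ∘ ((n₀ ∸ i ∸ q) ∷_)
    by-cases : ∀ b c →
               boxSum n′ (λ m → guard b (substFrom i F′ m) * guard c (substFrom (n₀ ∸ i) G′ (λ x → n′ x ∸ m x)))
               ≡ guard b (guard c (X (i ∸ p) (n₀ ∸ i ∸ q)))
    by-cases true  true  = trans (substFrom-mulS i (n₀ ∸ i) F′ G′ (Extensional-∷ G G-ext _) n′)
                                 (cong (λ t → substFrom t (mulS F′ G′) n′) (ℕₚ.m+[n∸m]≡n i≤n₀))
    by-cases true  false = boxSum-zero n′ (λ m → ℤₚ.*-zeroʳ (substFrom i F′ m))
    by-cases false c     = boxSum-zero n′ (λ m → refl)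

partialSums : ∀ {r} → ℕ → MultiIdx r → MultiIdx r
partialSums {zero}  p a ()
partialSums {suc r} p a = (p ℕ.+ head a) ∷ partialSums (p ℕ.+ head a) (tail a)

substFrom-mono : ∀ {r} p (a : MultiIdx r) → substFrom p (mono a) ≗ mono (partialSums p a)
substFrom-mono {zero}  p a m = refl
substFrom-mono {suc r} p a m = trans (substFrom-cons p (mono a) m) (first-entry (head m) (tail m))
  where
  a₀ = head a
  rest : Bool → MultiIdx r → ℤ
  rest b m′ = guard (b ∧ eqIdx (partialSums (p ℕ.+ a₀) (tail a)) m′) 1ℤ
  first-entry : ∀ m₀ (m′ : MultiIdx r) →
                guard (p ≤ᵇ m₀) (substFrom m₀ (mono a ∘ ((m₀ ∸ p) ∷_)) m′) ≡ rest (p ℕ.+ a₀ ≡ᵇ m₀) m′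
  first-entry m₀ m′ with p ≤ᵇ m₀ in p≤ᵇm₀
  ... | false = cong (λ b → rest b m′) (sym (≢⇒≡ᵇ≡false p+a₀≢m₀))
    where
    p+a₀≢m₀ : p ℕ.+ a₀ ≢ m₀
    p+a₀≢m₀ p+a₀≡m₀ with trans (sym (≤⇒≤ᵇ≡true (subst (p ≤_) p+a₀≡m₀ (ℕₚ.m≤m+n p a₀)))) p≤ᵇm₀
    ... | ()
  ... | true with a₀ ℕ.≟ m₀ ∸ p
  ...   | yes a₀≡ = begin
      substFrom m₀ (mono a ∘ ((m₀ ∸ p) ∷_)) m′
        ≡⟨ substFrom-cong m₀ (λ l → cong (λ b → guard (b ∧ eqIdx (tail a) l) 1ℤ) (≡⇒≡ᵇ≡true a₀≡)) m′ ⟩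
      substFrom m₀ (mono (tail a)) m′
        ≡⟨ substFrom-mono m₀ (tail a) m′ ⟩
      mono (partialSums m₀ (tail a)) m′
        ≡⟨ cong₂ (λ b c → guard (b ∧ eqIdx (partialSums c (tail a)) m′) 1ℤ) (sym (≡⇒≡ᵇ≡true p+a₀≡m₀)) (sym p+a₀≡m₀) ⟩
      rest (p ℕ.+ a₀ ≡ᵇ m₀) m′ ∎
    where
    open ≡-Reasoning
    p+a₀≡m₀ : p ℕ.+ a₀ ≡ m₀
    p+a₀≡m₀ = trans (cong (p ℕ.+_) a₀≡) (ℕₚ.m+[n∸m]≡n (≤ᵇ≡true⇒≤ {p} p≤ᵇm₀))
  ...   | no a₀≢ =
    trans (substFrom-zero m₀ (λ l → cong (λ b → guard (b ∧ eqIdx (tail a) l) 1ℤ) (≢⇒≡ᵇ≡false a₀≢)) m′)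
          (cong (λ b → rest b m′) (sym (≢⇒≡ᵇ≡false p+a₀≢m₀)))
    where
    p+a₀≢m₀ : p ℕ.+ a₀ ≢ m₀
    p+a₀≢m₀ p+a₀≡m₀ = a₀≢ (trans (sym (ℕₚ.m+n∸m≡n p a₀)) (cong (_∸ p) p+a₀≡m₀))

partialSums-zeros : ∀ {r} c → partialSums {r} c (λ _ → 0) ≗ λ _ → c
partialSums-zeros {suc r} c Fin.zero    = ℕₚ.+-identityʳ c
partialSums-zeros {suc r} c (Fin.suc i) = trans (partialSums-zeros (c ℕ.+ 0) i) (ℕₚ.+-identityʳ c)

partialSums-unit : ∀ {r} (j : Fin r) → partialSums 0 (λ i → if toℕ j ≡ᵇ toℕ i then 1 else 0) ≗ tailInd j
partialSums-unit Fin.zero    Fin.zero    = refl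
partialSums-unit Fin.zero    (Fin.suc i) = partialSums-zeros 1 i
partialSums-unit (Fin.suc j) Fin.zero    = refl
partialSums-unit (Fin.suc j) (Fin.suc i) =
  trans (partialSums-unit j i) (cong (λ b → if b then 1 else 0) (sym (≤ᵇ-suc (toℕ j) (toℕ i))))

substFrom-oneS : ∀ {r} → substFrom 0 (oneS {r}) ≗ oneS
substFrom-oneS m = trans (substFrom-mono 0 _ m) (mono-resp-≗ (partialSums-zeros 0) m)

substFrom-varS : ∀ {r} (j : Fin r) → substFrom 0 (varS j) ≗ mono (tailInd j)
substFrom-varS j m = trans (substFrom-mono 0 _ m) (mono-resp-≗ (partialSums-unit j) m)

substFrom-powS : ∀ {r} (F : Series r) e → substFrom 0 (powS F e) ≗ powS (substFrom 0 F) e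
substFrom-powS F zero    = substFrom-oneS
substFrom-powS F (suc e) n =
  trans (sym (substFrom-mulS 0 0 F (powS F e) (powS-extensional F e) n))
        (mulS-congʳ (substFrom 0 F) (substFrom-powS F e) n)

substFrom-prodS : ∀ {r s} (f : Fin s → Series r) → substFrom 0 (prodS f) ≗ prodS (substFrom 0 ∘ f)
substFrom-prodS {s = zero}  f = substFrom-oneS
substFrom-prodS {s = suc s} f n =
  trans (sym (substFrom-mulS 0 0 (head f) (prodS (tail f)) (prodS-extensional (tail f)) n))
        (mulS-congʳ (substFrom 0 (head f)) (substFrom-prodS (tail f)) n)

substFrom-denominator : ∀ {r} (k : Fin r → ℕ) →
                        substFrom 0 (denominator k) ≗ prodS (λ j → powS (subS oneS (mono (tailInd j))) (expo k j))
substFrom-denominator k n =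
  trans (substFrom-prodS (λ j → powS (subS oneS (varS j)) (expo k j)) n)
        (prodS-cong (λ j x → trans (substFrom-powS _ (expo k j) x) (powS-cong (1-yⱼ j) (expo k j) x)) n)
  where
  1-yⱼ : ∀ j → substFrom 0 (subS oneS (varS j)) ≗ subS oneS (mono (tailInd j))
  1-yⱼ j y = trans (substFrom-subS 0 oneS (varS j) y) (cong₂ _-_ (substFrom-oneS y) (substFrom-varS j y))

substFrom-LiSh : ∀ {r} p (k : Fin r → ℕ) → substFrom p (LiShFrom p k) ≗ λ m → + liStarGo p k m
substFrom-LiSh {zero}  p k m = refl
substFrom-LiSh {suc r} p k m = trans (substFrom-cons p (LiShFrom p k) m) (first-entry (head m) (tail m))
  where
  first-entry : ∀ m₀ (m′ : MultiIdx r) →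
                guard (p ≤ᵇ m₀) (substFrom m₀ (LiShFrom p k ∘ ((m₀ ∸ p) ∷_)) m′)
                ≡ + (if p <ᵇ m₀ then m₀ ℕ.^ head k ℕ.* liStarGo m₀ (tail k) m′ else 0)
  first-entry m₀ m′ with ℕₚ.<-cmp p m₀
  ... | tri< p<m₀ _ _ rewrite ≤⇒≤ᵇ≡true (ℕₚ.<⇒≤ p<m₀) | <⇒<ᵇ≡true p<m₀ = begin
      substFrom m₀ (LiShFrom p k ∘ ((m₀ ∸ p) ∷_)) m′
        ≡⟨ substFrom-cong m₀ peel m′ ⟩
      substFrom m₀ (λ l → + (m₀ ℕ.^ head k) * LiShFrom m₀ (tail k) l) m′
        ≡⟨ substFrom-*ˡ m₀ (+ (m₀ ℕ.^ head k)) (LiShFrom m₀ (tail k)) m′ ⟩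
      + (m₀ ℕ.^ head k) * substFrom m₀ (LiShFrom m₀ (tail k)) m′
        ≡⟨ cong (+ (m₀ ℕ.^ head k) *_) (substFrom-LiSh m₀ (tail k) m′) ⟩
      + (m₀ ℕ.^ head k) * + liStarGo m₀ (tail k) m′
        ≡⟨ ℤₚ.pos-* (m₀ ℕ.^ head k) (liStarGo m₀ (tail k) m′) ⟨
      + (m₀ ℕ.^ head k ℕ.* liStarGo m₀ (tail k) m′) ∎
    where
    open ≡-Reasoning
    peel : ∀ l → LiShFrom p k ((m₀ ∸ p) ∷ l) ≡ + (m₀ ℕ.^ head k) * LiShFrom m₀ (tail k) l
    peel l rewrite ≢⇒≡ᵇ≡false {m₀ ∸ p} {0} (ℕₚ.<⇒≱ p<m₀ ∘ ℕₚ.m∸n≡0⇒m≤n) | ℕₚ.m+[n∸m]≡n (ℕₚ.<⇒≤ p<m₀) =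
      ℤₚ.pos-* (m₀ ℕ.^ head k) (liShGo m₀ (tail k) l)
  ... | tri≈ _ refl _ rewrite ≤⇒≤ᵇ≡true (ℕₚ.≤-refl {p}) | ≮⇒<ᵇ≡false (ℕₚ.n≮n p) = substFrom-zero p l₀≡0 m′
    where
    l₀≡0 : ∀ l → LiShFrom p k ((p ∸ p) ∷ l) ≡ 0ℤ
    l₀≡0 l rewrite ℕₚ.n∸n≡0 p = refl
  ... | tri> _ _ m₀<p rewrite ≰⇒≤ᵇ≡false (ℕₚ.<⇒≱ m₀<p) | ≮⇒<ᵇ≡false (ℕₚ.<⇒≯ m₀<p) = refl

lemma5p5 : (r : ℕ) (k : Fin r → ℕ) →
    Σ (Series r) λ P →
      ((a : MultiIdx r) (j : Fin r) → expo k j < a j → P a ≡ 0ℤ)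
      × ((a : MultiIdx r) (j : Fin r) → a j ≡ 0 → P a ≡ 0ℤ)
      × ((n : MultiIdx r) →
           mulS (LiStar k) (prodS (λ j → powS (subS oneS (mono (tailInd j))) (expo k j))) n
             ≡ substY P n)
      × ((n : MultiIdx r) →
           mulS (LiSh k) (prodS (λ j → powS (subS oneS (varS j)) (expo k j))) n
             ≡ P n)
lemma5p5 r k =
    P
  , (λ a j e<aⱼ → trans (P≗numerator a) (numerator-degree k a j 0 e<aⱼ))
  , (λ a j aⱼ≡0 → trans (P≗numerator a) (numerator-vanishes k a j 0 aⱼ≡0))
  , z-form
  , (λ _ → refl)
  where
  P : Series r
  P = mulS (LiSh k) (denominator k)
  P≗numerator : P ≗ numerator 0 k
  P≗numerator = mulS-congʳ (LiSh k) (denominator-tensor k)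
  z-form : ∀ n → mulS (LiStar k) (prodS (λ j → powS (subS oneS (mono (tailInd j))) (expo k j))) n ≡ substY P n
  z-form n = begin
    mulS (LiStar k) (prodS (λ j → powS (subS oneS (mono (tailInd j))) (expo k j))) n
      ≡⟨ mulS-cong (sym ∘ substFrom-LiSh 0 k) (sym ∘ substFrom-denominator k) n ⟩
    mulS (substFrom 0 (LiSh k)) (substFrom 0 (denominator k)) n
      ≡⟨ substFrom-mulS 0 0 (LiSh k) (denominator k) (denominator-extensional k) n ⟩
    substFrom 0 P n
      ≡⟨ substY≗substFrom P n ⟨
    substY P n ∎
    where open ≡-Reasoning
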